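{- Let $M$ be a connected simple matroid of rank $3$ on $E$ with rank function $r$, and let $\{A_1,A_2,A_3\}$ be a 3-partition in $M$. Then $$\binom{|A_1|}{2}+\binom{|A_2|}{2}+\binom{|A_3|}{2}\ \ge\ \sum_{F\in\mathcal{F}^2} f(|F|),$$ where $\mathcal{F}^2$ is the set of subsets $F\subseteq E$ with $r(F)=2$ such that $(F,2)_\le$ is a facet-defining inequality of $\mathcal{B}(M)$, and $f(2k)=k(k-1)$, $f(2k+1)=k^2$ for nonnegative integers $k$.
   Context: $(A,a)_\le=\{I\subseteq E:|I\cap A|\le a\}$, $(A,a)_==\{I\subseteq E:|I\cap A|=a\}$. $\mathcal{B}(M)$ is the family of bases; a face of $\mathcal{B}(M)$ is $\mathcal{B}(M)\cap\bigcap_i(A_i,r(A_i))_=$, a facet is a maximal proper face, and $(F,r(F))_\le$ is facet-defining if $\mathcal{B}(M)\cap(F,r(F))_=$ is a facet. A partition $\{A_1,A_2,A_3\}$ of $E$ is a 3-partition in $M$ if $|A_1|,|A_2|,|A_3|\ge 2$; no $F\in\mathcal{F}^2$ meets all of $A_1,A_2,A_3$; and $r(A_1\cup A_2)=r(A_2\cup A_3)=r(A_3\cup A_1)=3$. -}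

module Defs where

open import Data.Nat using (ℕ; _+_; _*_; _∸_; _≤_; _<_; _%_; _≡ᵇ_; ⌊_/2⌋)
open import Data.Nat.Combinatorics using (_C_)
open import Data.Bool using (if_then_else_)
open import Data.Fin using (Fin)
open import Data.Fin.Subset using (Subset; ⊤; ⊥; _∈_; _⊆_; _⊂_; _∪_; _∩_; ∣_∣; Nonempty)
open import Data.List using (List; []; _∷_; map)
open import Data.Nat.ListAction using (sum)
open import Data.List.Relation.Unary.All using (All)
open import Data.Product using (Σ; ∃; _×_)
open import Relation.Nullary using (¬_)
open import Relation.Binary.PropositionalEquality using (_≡_; _≢_)

record Matroid (n : ℕ) : Set where
  field
    r       : Subset n → ℕ
    r-bound : ∀ X → r X ≤ ∣ X ∣
    r-mono  : ∀ X Y → X ⊆ Y → r X ≤ r Y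
    r-submod : ∀ X Y → r (X ∪ Y) + r (X ∩ Y) ≤ r X + r Y

module _ {n : ℕ} (M : Matroid n) where
  open Matroid M

  Independent : Subset n → Set
  Independent X = r X ≡ ∣ X ∣

  IsBase : Subset n → Set
  IsBase B = Independent B × (∀ Y → B ⊆ Y → Independent Y → Y ≡ B)

  IsCircuit : Subset n → Set
  IsCircuit C = ¬ Independent C × (∀ D → D ⊂ C → Independent D)

  Connected : Set
  Connected = ∀ (e f : Fin n) → e ≢ f → ∃ λ C → IsCircuit C × e ∈ C × f ∈ C

  -- simple: no loops and no parallel pairs, i.e. all sets of size ≤ 2 independent
  Simple : Set
  Simple = ∀ X → ∣ X ∣ ≤ 2 → Independent X

  HasRank : ℕ → Set
  HasRank k = r ⊤ ≡ k

  -- the face B(M) ∩ ⋂_{A ∈ As} (A , r(A))_=  as a family of subsets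
  Face : List (Subset n) → Subset n → Set
  Face As X = IsBase X × All (λ A → ∣ X ∩ A ∣ ≡ r A) As

  ProperFace : List (Subset n) → Set
  ProperFace As = ∃ λ X → IsBase X × ¬ Face As X

  IsFacet : List (Subset n) → Set
  IsFacet As = ProperFace As
             × (∀ Bs → (∀ X → Face As X → Face Bs X) → ProperFace Bs
                     → ∀ X → Face Bs X → Face As X)

  FacetDefining : Subset n → Set
  FacetDefining F = IsFacet (F ∷ [])

  InF2 : Subset n → Set
  InF2 F = r F ≡ 2 × FacetDefining F

  ThreePartition : Subset n → Subset n → Subset n → Set
  ThreePartition A₁ A₂ A₃ =
      (A₁ ∪ A₂ ∪ A₃ ≡ ⊤)
    × (A₁ ∩ A₂ ≡ ⊥) × (A₂ ∩ A₃ ≡ ⊥) × (A₃ ∩ A₁ ≡ ⊥)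
    × (2 ≤ ∣ A₁ ∣) × (2 ≤ ∣ A₂ ∣) × (2 ≤ ∣ A₃ ∣)
    × (∀ F → InF2 F → ¬ (Nonempty (F ∩ A₁) × Nonempty (F ∩ A₂) × Nonempty (F ∩ A₃)))
    × (r (A₁ ∪ A₂) ≡ 3) × (r (A₂ ∪ A₃) ≡ 3) × (r (A₃ ∪ A₁) ≡ 3)

f : ℕ → ℕ
f m = if m % 2 ≡ᵇ 0 then k * (k ∸ 1) else k * k
  where k = ⌊ m /2⌋

binomSum : {n : ℕ} → Subset n → Subset n → Subset n → ℕ
binomSum A₁ A₂ A₃ = (∣ A₁ ∣ C 2) + (∣ A₂ ∣ C 2) + (∣ A₃ ∣ C 2)

fSum : {n : ℕ} → List (Subset n) → ℕ
fSum Fs = sum (map (λ F → f ∣ F ∣) Fs)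

module Submission where

-- The members of 𝓕² behave like the lines of a linear space: two distinct ones
-- share at most one point.  A facet-defining rank-2 set F is closed, because
-- if r(F ∪ e) = 2 for some e ∉ F then the face of F ∪ e contains the face of
-- F, so by maximality of the facet the two faces coincide, while a base through
-- e and a point of F lies on the first face but not on the second.  This needs
-- the face of F ∪ e to be proper, which the rank-3 conditions of the
-- 3-partition guarantee for every rank-2 set.  Consequently the traces F ∩ Aᵢ
-- of the lines pairwise share at most one point, and a pair-packing argument
-- gives Σ_F C(|F ∩ Aᵢ|,2) ≤ C(|Aᵢ|,2) for each part.  Finally no line meets
-- all three parts, and f(a + b) ≤ C(a,2) + C(b,2) (f(m) is the least number of
-- pairs within the parts of a split of m points into two parts), so f(|F|) is
-- paid for by the pairs inside the traces of F.

open import Defs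
open import Algebra.Properties.CommutativeSemigroup using (interchange)
open import Data.Bool using (true; false; _∧_)
open import Data.Empty using (⊥-elim)
open import Data.Fin using (Fin)
open import Data.Fin.Properties using (any?)
open import Data.Fin.Subset
open import Data.Fin.Subset.Properties
open import Data.List using (List; []; _∷_; map)
open import Data.List.Properties using (map-∘)
open import Data.List.Membership.Propositional using () renaming (_∈_ to _∈ₗ_)
open import Data.List.Relation.Unary.All as All using (All; []; _∷_)
import Data.List.Relation.Unary.All.Properties as AllProp
open import Data.List.Relation.Unary.AllPairs as AllPairs using (AllPairs; []; _∷_)
import Data.List.Relation.Unary.AllPairs.Properties as AllPairsProp
open import Data.List.Relation.Unary.Unique.Propositional using (Unique)
open import Data.Nat
  using (ℕ; zero; suc; _+_; _*_; _∸_; _≤_; _<_; _%_; _≡ᵇ_; ⌊_/2⌋; z≤n; s≤s; _≤′_; ≤′-refl; ≤′-step)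
open import Data.Nat.Combinatorics using (_C_; nCk+nC[k+1]≡[n+1]C[k+1]; nC1≡n)
open import Data.Nat.ListAction using (sum)
open import Data.Nat.Properties
open import Data.Nat.Tactic.RingSolver using (solve-∀)
open import Data.Product using (_×_; _,_; proj₁; proj₂; ∃; ∃₂)
open import Data.Sum using (_⊎_; inj₁; inj₂; [_,_]′; map₂)
open import Data.Vec using ([]; _∷_; tail; here)
open import Function using (_∘_)
open import Relation.Binary.PropositionalEquality
open import Relation.Nullary using (¬_; Dec; yes; no; contradiction)
open import Relation.Nullary.Decidable using (_×-dec_; ¬?)

open Matroid

C2-suc : ∀ m → suc m C 2 ≡ m C 2 + m
C2-suc m = begin
  suc m C 2      ≡⟨ nCk+nC[k+1]≡[n+1]C[k+1] m 1 ⟨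
  m C 1 + m C 2  ≡⟨ cong (_+ m C 2) (nC1≡n m) ⟩
  m + m C 2      ≡⟨ +-comm m (m C 2) ⟩
  m C 2 + m      ∎
  where open ≡-Reasoning

parity : ∀ m → ((m % 2 ≡ᵇ 0) ≡ true  × m ≡ ⌊ m /2⌋ + ⌊ m /2⌋)
             ⊎ ((m % 2 ≡ᵇ 0) ≡ false × m ≡ suc (⌊ m /2⌋ + ⌊ m /2⌋))
parity 0 = inj₁ (refl , refl)
parity 1 = inj₂ (refl , refl)
parity (suc (suc m)) with parity m
... | inj₁ (even , m≡) =
  inj₁ (even , cong suc (trans (cong suc m≡) (sym (+-suc ⌊ m /2⌋ ⌊ m /2⌋))))
... | inj₂ (odd , m≡) =
  inj₂ (odd , cong suc (trans (cong suc m≡) (cong suc (sym (+-suc ⌊ m /2⌋ ⌊ m /2⌋)))))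

even-step : ∀ k → suc k * k ≡ k * (k ∸ 1) + (k + k)
even-step zero    = refl
even-step (suc k) = shifted k
  where
  shifted : ∀ k → suc (suc k) * suc k ≡ suc k * k + (suc k + suc k)
  shifted = solve-∀

odd-step : ∀ k → suc k * suc k ≡ k * k + suc (k + k)
odd-step = solve-∀

-- f(m+2) = f(m) + m: two more points in a balanced split create m more pairs.
f-step : ∀ m → f (2 + m) ≡ f m + m
f-step m with parity m
... | inj₁ (even , m≡2k) rewrite even =
  trans (even-step ⌊ m /2⌋) (cong (⌊ m /2⌋ * (⌊ m /2⌋ ∸ 1) +_) (sym m≡2k))
... | inj₂ (odd , m≡2k+1) rewrite odd =
  trans (odd-step ⌊ m /2⌋) (cong (⌊ m /2⌋ * ⌊ m /2⌋ +_) (sym m≡2k+1))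

f-growth : ∀ m → f m ≤ f (suc m) × f (suc m) ≤ f m + m
f-growth zero    = z≤n , z≤n
f-growth (suc m) with f-growth m
... | up , bounded rewrite f-step m = bounded , +-mono-≤ up (n≤1+n m)

f-mono : ∀ {a b} → a ≤ b → f a ≤ f b
f-mono = go ∘ ≤⇒≤′
  where
  go : ∀ {a b} → a ≤′ b → f a ≤ f b
  go ≤′-refl        = ≤-refl
  go (≤′-step {b} a≤′b) = ≤-trans (go a≤′b) (proj₁ (f-growth b))

f≤C2 : ∀ m → f m ≤ m C 2
f≤C2 0 = z≤n
f≤C2 1 = z≤n
f≤C2 (suc (suc m)) = begin
  f (2 + m)                  ≡⟨ f-step m ⟩
  f m + m                    ≤⟨ +-monoˡ-≤ m (f≤C2 m) ⟩
  m C 2 + m                  ≤⟨ m≤m+n (m C 2 + m) (suc m) ⟩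
  m C 2 + m + suc m          ≡⟨ cong (_+ suc m) (C2-suc m) ⟨
  suc m C 2 + suc m          ≡⟨ C2-suc (suc m) ⟨
  suc (suc m) C 2            ∎
  where open ≤-Reasoning

f-split : ∀ a b → f (a + b) ≤ a C 2 + b C 2
f-split zero    b       = f≤C2 b
f-split (suc a) zero    = subst (λ k → f k ≤ suc a C 2 + 0) (sym (+-identityʳ (suc a)))
                                (≤-trans (f≤C2 (suc a)) (m≤m+n _ 0))
f-split (suc a) (suc b) = begin
  f (suc a + suc b)            ≡⟨ cong (f ∘ suc) (+-suc a b) ⟩
  f (2 + (a + b))              ≡⟨ f-step (a + b) ⟩
  f (a + b) + (a + b)          ≤⟨ +-monoˡ-≤ (a + b) (f-split a b) ⟩
  a C 2 + b C 2 + (a + b)      ≡⟨ interchange +-commutativeSemigroup (a C 2) (b C 2) a b ⟩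
  (a C 2 + a) + (b C 2 + b)    ≡⟨ cong₂ _+_ (C2-suc a) (C2-suc b) ⟨
  suc a C 2 + suc b C 2        ∎
  where open ≤-Reasoning

f-bound : ∀ {m} a b → m ≤ a + b → f m ≤ a C 2 + b C 2
f-bound a b m≤a+b = ≤-trans (f-mono m≤a+b) (f-split a b)

∣p∪q∣≤∣p∣+∣q∣ : ∀ {n} (p q : Subset n) → ∣ p ∪ q ∣ ≤ ∣ p ∣ + ∣ q ∣
∣p∪q∣≤∣p∣+∣q∣ []            []            = z≤n
∣p∪q∣≤∣p∣+∣q∣ (outside ∷ p) (outside ∷ q) = ∣p∪q∣≤∣p∣+∣q∣ p q
∣p∪q∣≤∣p∣+∣q∣ (outside ∷ p) (inside  ∷ q) =
  ≤-trans (s≤s (∣p∪q∣≤∣p∣+∣q∣ p q)) (≤-reflexive (sym (+-suc ∣ p ∣ ∣ q ∣)))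
∣p∪q∣≤∣p∣+∣q∣ (inside  ∷ p) (outside ∷ q) = s≤s (∣p∪q∣≤∣p∣+∣q∣ p q)
∣p∪q∣≤∣p∣+∣q∣ (inside  ∷ p) (inside  ∷ q) =
  s≤s (≤-trans (∣p∪q∣≤∣p∣+∣q∣ p q) (+-monoʳ-≤ ∣ p ∣ (n≤1+n ∣ q ∣)))

∣p∣+∣q∖p∣≡∣q∣ : ∀ {n} {p q : Subset n} → p ⊆ q → ∣ p ∣ + ∣ q ∩ ∁ p ∣ ≡ ∣ q ∣
∣p∣+∣q∖p∣≡∣q∣ {p = []}          {[]}          _   = refl
∣p∣+∣q∖p∣≡∣q∣ {p = outside ∷ p} {outside ∷ q} p⊆q = ∣p∣+∣q∖p∣≡∣q∣ (drop-∷-⊆ p⊆q)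
∣p∣+∣q∖p∣≡∣q∣ {p = outside ∷ p} {inside  ∷ q} p⊆q =
  trans (+-suc ∣ p ∣ _) (cong suc (∣p∣+∣q∖p∣≡∣q∣ (drop-∷-⊆ p⊆q)))
∣p∣+∣q∖p∣≡∣q∣ {p = inside  ∷ p} {inside  ∷ q} p⊆q = cong suc (∣p∣+∣q∖p∣≡∣q∣ (drop-∷-⊆ p⊆q))
∣p∣+∣q∖p∣≡∣q∣ {p = inside  ∷ p} {outside ∷ q} p⊆q = contradiction (p⊆q here) λ ()

∈⇒1≤∣∣ : ∀ {n} {x : Fin n} {p : Subset n} → x ∈ p → 1 ≤ ∣ p ∣
∈⇒1≤∣∣ x∈p = ≤-trans (s≤s z≤n) (x∈p⇒∣p-x∣<∣p∣ x∈p)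

two-elements⇒2≤∣∣ : ∀ {n} {x y : Fin n} {p : Subset n} → x ≢ y → x ∈ p → y ∈ p → 2 ≤ ∣ p ∣
two-elements⇒2≤∣∣ x≢y x∈p y∈p =
  ≤-trans (s≤s (∈⇒1≤∣∣ (x∈p∧x≢y⇒x∈p-y y∈p (x≢y ∘ sym)))) (x∈p⇒∣p-x∣<∣p∣ x∈p)

1≤∣∣⇒nonempty : ∀ {n} {p : Subset n} → 1 ≤ ∣ p ∣ → Nonempty p
1≤∣∣⇒nonempty {n} {p} 1≤∣p∣ with nonempty? p
... | yes nonempty = nonempty
... | no empty     = contradiction (subst (1 ≤_) ∣p∣≡0 1≤∣p∣) λ ()
  where
  ∣p∣≡0 : ∣ p ∣ ≡ 0
  ∣p∣≡0 = trans (cong ∣_∣ (Empty-unique empty)) (∣⊥∣≡0 n)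

⊈⇒∃∉ : ∀ {n} {p q : Subset n} → p ⊈ q → ∃ λ x → x ∈ p × x ∉ q
⊈⇒∃∉ {p = p} {q} p⊈q with any? (λ x → x ∈? p ×-dec ¬? (x ∈? q))
... | yes witness = witness
... | no none     = ⊥-elim (p⊈q p⊆q)
  where
  p⊆q : p ⊆ q
  p⊆q {x} x∈p with x ∈? q
  ... | yes x∈q = x∈q
  ... | no x∉q  = contradiction (x , x∈p , x∉q) none

2≤∣∣⇒two-elements : ∀ {n} {p : Subset n} → 2 ≤ ∣ p ∣ → ∃₂ λ x y → x ≢ y × x ∈ p × y ∈ p
2≤∣∣⇒two-elements {p = p} 2≤∣p∣ with 1≤∣∣⇒nonempty (≤-trans (s≤s z≤n) 2≤∣p∣)
... | x , x∈p with ⊈⇒∃∉ p⊈⁅x⁆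
  where
  p⊈⁅x⁆ : p ⊈ ⁅ x ⁆
  p⊈⁅x⁆ p⊆⁅x⁆ = <⇒≱ 2≤∣p∣ (≤-trans (p⊆q⇒∣p∣≤∣q∣ p⊆⁅x⁆) (≤-reflexive (∣⁅x⁆∣≡1 x)))
... | y , y∈p , y∉⁅x⁆ = x , y , x∉⁅y⁆⇒x≢y y∉⁅x⁆ ∘ sym , x∈p , y∈p

∪-least : ∀ {n} {p q s : Subset n} → p ⊆ s → q ⊆ s → p ∪ q ⊆ s
∪-least {p = p} {q} p⊆s q⊆s x∈p∪q = [ p⊆s , q⊆s ]′ (x∈p∪q⁻ p q x∈p∪q)

∩-monoʳ : ∀ {n} (s : Subset n) {p q : Subset n} → p ⊆ q → s ∩ p ⊆ s ∩ q
∩-monoʳ s {p} p⊆q x∈s∩p = let x∈s , x∈p = x∈p∩q⁻ s p x∈s∩p in x∈p∩q⁺ (x∈s , p⊆q x∈p)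

⁅⁆⊆ : ∀ {n} {x : Fin n} {p : Subset n} → x ∈ p → ⁅ x ⁆ ⊆ p
⁅⁆⊆ {x = x} x∈p y∈⁅x⁆ = subst (_∈ _) (sym (x∈⁅y⁆⇒x≡y x y∈⁅x⁆)) x∈p

∣pair∣≤2 : ∀ {n} (x y : Fin n) → ∣ ⁅ x ⁆ ∪ ⁅ y ⁆ ∣ ≤ 2
∣pair∣≤2 x y = ≤-trans (∣p∪q∣≤∣p∣+∣q∣ ⁅ x ⁆ ⁅ y ⁆) (≤-reflexive (cong₂ _+_ (∣⁅x⁆∣≡1 x) (∣⁅x⁆∣≡1 y)))

disjoint⇒∉ : ∀ {n} {p q : Subset n} {x : Fin n} → p ∩ q ≡ ⊥ → x ∈ p → x ∉ q
disjoint⇒∉ {x = x} p∩q≡⊥ x∈p x∈q = ∉⊥ (subst (x ∈_) p∩q≡⊥ (x∈p∩q⁺ (x∈p , x∈q)))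

separated : ∀ {n} {p q s : Subset n} {x y : Fin n}
          → p ∩ q ≡ ⊥ → p ∩ s ≡ ⊥ → x ∈ p → y ∈ q ∪ s → x ≢ y
separated {q = q} {s} p∩q≡⊥ p∩s≡⊥ x∈p y∈q∪s refl =
  [ disjoint⇒∉ p∩q≡⊥ x∈p , disjoint⇒∉ p∩s≡⊥ x∈p ]′ (x∈p∪q⁻ q s y∈q∪s)

trace-misses-two : ∀ {n} {B G : Subset n} {x y : Fin n}
                 → x ≢ y → x ∈ B → y ∈ B → x ∉ G → y ∉ G → 2 + ∣ B ∩ G ∣ ≤ ∣ B ∣
trace-misses-two {B = B} {G} {x} {y} x≢y x∈B y∈B x∉G y∉G = begin
  2 + ∣ B ∩ G ∣       ≤⟨ s≤s (s≤s (p⊆q⇒∣p∣≤∣q∣ B∩G⊆B-x-y)) ⟩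
  2 + ∣ B - x - y ∣   ≤⟨ s≤s (x∈p⇒∣p-x∣<∣p∣ (x∈p∧x≢y⇒x∈p-y y∈B (x≢y ∘ sym))) ⟩
  suc ∣ B - x ∣       ≤⟨ x∈p⇒∣p-x∣<∣p∣ x∈B ⟩
  ∣ B ∣               ∎
  where
  open ≤-Reasoning
  B∩G⊆B-x-y : B ∩ G ⊆ B - x - y
  B∩G⊆B-x-y z∈B∩G =
    let z∈B , z∈G = x∈p∩q⁻ B G z∈B∩G
    in x∈p∧x≢y⇒x∈p-y (x∈p∧x≢y⇒x∈p-y z∈B λ { refl → x∉G z∈G }) λ { refl → y∉G z∈G }

sum-mono : ∀ {A : Set} {g h : A → ℕ} {xs : List A}
         → All (λ x → g x ≤ h x) xs → sum (map g xs) ≤ sum (map h xs)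
sum-mono []          = z≤n
sum-mono (le ∷ les) = +-mono-≤ le (sum-mono les)

sum-+ : ∀ {A : Set} (g h : A → ℕ) (xs : List A)
      → sum (map (λ x → g x + h x) xs) ≡ sum (map g xs) + sum (map h xs)
sum-+ g h []       = refl
sum-+ g h (x ∷ xs) =
  trans (cong (g x + h x +_) (sum-+ g h xs)) (interchange +-commutativeSemigroup (g x) (h x) _ _)

AllPairs-strengthen : ∀ {A : Set} {P : A → Set} {R S : A → A → Set}
                    → (∀ {x y} → P x → P y → R x y → S x y)
                    → ∀ {xs} → All P xs → AllPairs R xs → AllPairs S xs
AllPairs-strengthen R⇒S []         []           = []
AllPairs-strengthen R⇒S (px ∷ pxs) (Rx ∷ Rxs) =
  All.zipWith (λ (py , Rxy) → R⇒S px py Rxy) (pxs , Rx) ∷ AllPairs-strengthen R⇒S pxs Rxs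

pairCount : ∀ {n} → List (Subset n) → ℕ
pairCount Ss = sum (map (λ S → ∣ S ∣ C 2) Ss)

_Meets≤1_ : ∀ {n} → Subset n → Subset n → Set
S Meets≤1 T = ∣ S ∩ T ∣ ≤ 1

_Disjoint_ : ∀ {n} → Subset n → Subset n → Set
S Disjoint T = ∣ S ∩ T ∣ ≡ 0

disjoint-sum : ∀ {n} (A : Subset n) (Ss : List (Subset n))
             → All (_⊆ A) Ss → AllPairs _Disjoint_ Ss → sum (map ∣_∣ Ss) ≤ ∣ A ∣
disjoint-sum A []       _                 _                = z≤n
disjoint-sum A (S ∷ Ss) (S⊆A ∷ Ss⊆A) (S#Ss ∷ Ss-disjoint) = begin
  ∣ S ∣ + sum (map ∣_∣ Ss)  ≤⟨ +-monoʳ-≤ ∣ S ∣ rest ⟩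
  ∣ S ∣ + ∣ A ∩ ∁ S ∣       ≡⟨ ∣p∣+∣q∖p∣≡∣q∣ S⊆A ⟩
  ∣ A ∣                     ∎
  where
  open ≤-Reasoning
  avoid : ∀ {T} → T ⊆ A × S Disjoint T → T ⊆ A ∩ ∁ S
  avoid (T⊆A , S#T) {x} x∈T with x ∈? S
  ... | yes x∈S = contradiction (subst (1 ≤_) S#T (∈⇒1≤∣∣ (x∈p∩q⁺ (x∈S , x∈T)))) λ ()
  ... | no x∉S  = x∈p∩q⁺ (T⊆A x∈T , x∉p⇒x∈∁p x∉S)
  rest : sum (map ∣_∣ Ss) ≤ ∣ A ∩ ∁ S ∣
  rest = disjoint-sum (A ∩ ∁ S) Ss (All.zipWith avoid (Ss⊆A , S#Ss)) Ss-disjoint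

link : ∀ {n} → List (Subset (suc n)) → List (Subset n)
link []                   = []
link ((outside ∷ S) ∷ Ss) = link Ss
link ((inside  ∷ S) ∷ Ss) = S ∷ link Ss

-- A covered pair either avoids the first point or joins it to a point of the link.
pairCount-split : ∀ {n} (Ss : List (Subset (suc n)))
                → pairCount Ss ≡ pairCount (map tail Ss) + sum (map ∣_∣ (link Ss))
pairCount-split [] = refl
pairCount-split ((outside ∷ S) ∷ Ss) =
  trans (cong (∣ S ∣ C 2 +_) (pairCount-split Ss)) (sym (+-assoc (∣ S ∣ C 2) _ _))
pairCount-split ((inside ∷ S) ∷ Ss) =
  trans (cong₂ _+_ (C2-suc ∣ S ∣) (pairCount-split Ss))
        (interchange +-commutativeSemigroup (∣ S ∣ C 2) ∣ S ∣ _ _)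

link-empty : ∀ {n} {A : Subset n} {Ss} → All (_⊆ outside ∷ A) Ss → link Ss ≡ []
link-empty {Ss = []}                   []          = refl
link-empty {Ss = (outside ∷ S) ∷ Ss}   (_ ∷ Ss⊆)   = link-empty Ss⊆
link-empty {Ss = (inside  ∷ S) ∷ Ss}   (S⊆ ∷ _)    = contradiction (S⊆ here) λ ()

link-⊆ : ∀ {n} {A : Subset n} {Ss} → All (_⊆ inside ∷ A) Ss → All (_⊆ A) (link Ss)
link-⊆ {Ss = []}                 []          = []
link-⊆ {Ss = (outside ∷ S) ∷ Ss} (_ ∷ Ss⊆)   = link-⊆ Ss⊆
link-⊆ {Ss = (inside  ∷ S) ∷ Ss} (S⊆ ∷ Ss⊆) = drop-∷-⊆ S⊆ ∷ link-⊆ Ss⊆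

-- Two members through the first point meet nowhere else, so the link is disjoint.
link-disjoint : ∀ {n} {Ss : List (Subset (suc n))}
              → AllPairs _Meets≤1_ Ss → AllPairs _Disjoint_ (link Ss)
link-disjoint {Ss = []}                 []             = []
link-disjoint {Ss = (outside ∷ S) ∷ Ss} (_ ∷ meets)    = link-disjoint meets
link-disjoint {Ss = (inside  ∷ S) ∷ Ss} (S-meets ∷ meets) = through S-meets ∷ link-disjoint meets
  where
  through : ∀ {Ts} → All ((inside ∷ S) Meets≤1_) Ts → All (S Disjoint_) (link Ts)
  through {[]}                 []          = []
  through {(outside ∷ T) ∷ Ts} (_ ∷ Ts1)   = through Ts1
  through {(inside  ∷ T) ∷ Ts} (s≤s S∩T≤0 ∷ Ts1) = n≤0⇒n≡0 S∩T≤0 ∷ through Ts1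

tail-⊆ : ∀ {n} {a} {A : Subset n} {S : Subset (suc n)} → S ⊆ a ∷ A → tail S ⊆ A
tail-⊆ {S = s ∷ S} = drop-∷-⊆

tail-meets : ∀ {n} {S T : Subset (suc n)} → S Meets≤1 T → tail S Meets≤1 tail T
tail-meets {S = s ∷ S} {t ∷ T} S∩T≤1 = ≤-trans (∣p∣≤∣x∷p∣ (s ∧ t) (S ∩ T)) S∩T≤1

-- Pair packing: subsets of A pairwise sharing at most one point cover at most
-- C(|A|,2) pairs.  Induction on the ground set, splitting off the first point.
pair-packing : ∀ {n} (A : Subset n) (Ss : List (Subset n))
             → All (_⊆ A) Ss → AllPairs _Meets≤1_ Ss → pairCount Ss ≤ ∣ A ∣ C 2
pair-packing []      []       _           _           = z≤n
pair-packing []      ([] ∷ Ss) (_ ∷ Ss⊆) (_ ∷ meets) = pair-packing [] Ss Ss⊆ meets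
pair-packing (a ∷ A) Ss       Ss⊆         meets       =
  ≤-trans (≤-reflexive (pairCount-split Ss)) (with-first-point a Ss⊆)
  where
  tails : pairCount (map tail Ss) ≤ ∣ A ∣ C 2
  tails = pair-packing A (map tail Ss) (AllProp.map⁺ (All.map tail-⊆ Ss⊆))
            (AllPairsProp.map⁺ {f = tail} (AllPairs.map (λ {S} {T} → tail-meets {S = S} {T}) meets))
  with-first-point : ∀ a → All (_⊆ a ∷ A) Ss
                   → pairCount (map tail Ss) + sum (map ∣_∣ (link Ss)) ≤ ∣ a ∷ A ∣ C 2
  with-first-point outside Ss⊆ rewrite link-empty Ss⊆ = ≤-trans (≤-reflexive (+-identityʳ _)) tails
  with-first-point inside  Ss⊆ = begin
    pairCount (map tail Ss) + sum (map ∣_∣ (link Ss))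
      ≤⟨ +-mono-≤ tails (disjoint-sum A (link Ss) (link-⊆ Ss⊆) (link-disjoint meets)) ⟩
    ∣ A ∣ C 2 + ∣ A ∣
      ≡⟨ C2-suc ∣ A ∣ ⟨
    suc ∣ A ∣ C 2
      ∎
    where open ≤-Reasoning

traces-packing : ∀ {n} (A : Subset n) {Fs : List (Subset n)}
               → AllPairs _Meets≤1_ Fs → sum (map (λ F → ∣ F ∩ A ∣ C 2) Fs) ≤ ∣ A ∣ C 2
traces-packing A {Fs} meets = begin
  sum (map (λ F → ∣ F ∩ A ∣ C 2) Fs)  ≡⟨ cong sum (map-∘ Fs) ⟩
  pairCount (map (_∩ A) Fs)           ≤⟨ pair-packing A (map (_∩ A) Fs) traces⊆A trace-meets ⟩
  ∣ A ∣ C 2                           ∎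
  where
  open ≤-Reasoning
  traces⊆A : All (_⊆ A) (map (_∩ A) Fs)
  traces⊆A = AllProp.map⁺ (All.universal (λ F {x} → p∩q⊆q F A {x}) Fs)
  restrict : ∀ {S T} → S Meets≤1 T → (S ∩ A) Meets≤1 (T ∩ A)
  restrict {S} {T} = ≤-trans (p⊆q⇒∣p∣≤∣q∣ λ x∈ →
    let x∈S∩A , x∈T∩A = x∈p∩q⁻ (S ∩ A) (T ∩ A) x∈
    in x∈p∩q⁺ (proj₁ (x∈p∩q⁻ S A x∈S∩A) , proj₁ (x∈p∩q⁻ T A x∈T∩A)))
  trace-meets : AllPairs _Meets≤1_ (map (_∩ A) Fs)
  trace-meets = AllPairsProp.map⁺ {f = _∩ A} (AllPairs.map (λ {S} {T} → restrict {S} {T}) meets)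

module _ {n : ℕ} (M : Matroid n) where

  independent-⊆ : ∀ {X Y} → Y ⊆ X → Independent M X → Independent M Y
  independent-⊆ {X} {Y} Y⊆X indX = ≤-antisym (r-bound M Y) (+-cancelʳ-≤ ∣ Z ∣ ∣ Y ∣ (r M Y) chain)
    where
    Z = X ∩ ∁ Y
    X⊆Y∪Z : X ⊆ Y ∪ Z
    X⊆Y∪Z {x} x∈X with x ∈? Y
    ... | yes x∈Y = x∈p∪q⁺ (inj₁ x∈Y)
    ... | no x∉Y  = x∈p∪q⁺ (inj₂ (x∈p∩q⁺ (x∈X , x∉p⇒x∈∁p x∉Y)))
    chain : ∣ Y ∣ + ∣ Z ∣ ≤ r M Y + ∣ Z ∣
    chain = begin
      ∣ Y ∣ + ∣ Z ∣                ≡⟨ ∣p∣+∣q∖p∣≡∣q∣ Y⊆X ⟩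
      ∣ X ∣                        ≡⟨ indX ⟨
      r M X                        ≤⟨ r-mono M X (Y ∪ Z) X⊆Y∪Z ⟩
      r M (Y ∪ Z)                  ≤⟨ m≤m+n _ _ ⟩
      r M (Y ∪ Z) + r M (Y ∩ Z)    ≤⟨ r-submod M Y Z ⟩
      r M Y + r M Z                ≤⟨ +-monoʳ-≤ (r M Y) (r-bound M Z) ⟩
      r M Y + ∣ Z ∣                ∎
      where open ≤-Reasoning

  ∣I∩G∣≤r : ∀ {I} G → Independent M I → ∣ I ∩ G ∣ ≤ r M G
  ∣I∩G∣≤r {I} G indI = begin
    ∣ I ∩ G ∣    ≡⟨ independent-⊆ (p∩q⊆p I G) indI ⟨
    r M (I ∩ G)  ≤⟨ r-mono M _ _ (p∩q⊆q I G) ⟩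
    r M G        ∎
    where open ≤-Reasoning

  base-size : ∀ {B} → IsBase M B → ∣ B ∣ ≤ r M ⊤
  base-size {B} (indB , _) = ≤-trans (≤-reflexive (sym indB)) (r-mono M B ⊤ ⊆⊤)

  escape : ∀ {A G} → r M G < r M A → ∃ λ x → x ∈ A × x ∉ G
  escape {A} {G} rG<rA = ⊈⇒∃∉ λ A⊆G → <⇒≱ rG<rA (r-mono M A G A⊆G)

  saturated⇒base : ∀ {I} → Independent M I
                 → (∀ x → x ∉ I → ¬ Independent M (I ∪ ⁅ x ⁆)) → IsBase M I
  saturated⇒base {I} indI saturated = indI , λ Y I⊆Y indY → ⊆-antisym (Y⊆I I⊆Y indY) I⊆Y
    where
    Y⊆I : ∀ {Y} → I ⊆ Y → Independent M Y → Y ⊆ I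
    Y⊆I I⊆Y indY {x} x∈Y with x ∈? I
    ... | yes x∈I = x∈I
    ... | no x∉I  = contradiction (independent-⊆ (∪-least I⊆Y (⁅⁆⊆ x∈Y)) indY) (saturated x x∉I)

  -- Every independent set extends to a base.  The fuel k, with n ≤ k + |I|,
  -- bounds the number of points that can still be added.
  extend-to-base : ∀ {I} → Independent M I → ∃ λ B → I ⊆ B × IsBase M B
  extend-to-base {I₀} = grow n I₀ (m≤m+n n ∣ I₀ ∣)
    where
    grow : ∀ k I → n ≤ k + ∣ I ∣ → Independent M I → ∃ λ B → I ⊆ B × IsBase M B
    grow k I room indI with any? (λ x → ¬? (x ∈? I) ×-dec (r M (I ∪ ⁅ x ⁆) ≟ ∣ I ∪ ⁅ x ⁆ ∣))
    ... | no none = I , (λ x∈I → x∈I) , saturated⇒base indI (λ x x∉I indx → none (x , x∉I , indx))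
    ... | yes (x , x∉I , indx) = add k room
      where
      larger : ∣ I ∣ < ∣ I ∪ ⁅ x ⁆ ∣
      larger = p⊂q⇒∣p∣<∣q∣ (p⊆p∪q ⁅ x ⁆ , x , x∈p∪q⁺ (inj₂ (x∈⁅x⁆ x)) , x∉I)
      add : ∀ j → n ≤ j + ∣ I ∣ → ∃ λ B → I ⊆ B × IsBase M B
      add zero    room₀ = contradiction (≤-trans (∣p∣≤n (I ∪ ⁅ x ⁆)) room₀) (<⇒≱ larger)
      add (suc j) room₊ =
        let B , I∪x⊆B , isB = grow j (I ∪ ⁅ x ⁆) room′ indx
        in B , I∪x⊆B ∘ p⊆p∪q ⁅ x ⁆ , isB
        where
        room′ : n ≤ j + ∣ I ∪ ⁅ x ⁆ ∣
        room′ = ≤-trans room₊ (≤-trans (≤-reflexive (sym (+-suc j ∣ I ∣))) (+-monoʳ-≤ j larger))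

  union-rank≤2 : ∀ {F F'} → r M F ≡ 2 → r M F' ≡ 2 → 2 ≤ r M (F ∩ F') → r M (F ∪ F') ≤ 2
  union-rank≤2 {F} {F'} rF≡2 rF'≡2 2≤r∩ = +-cancelʳ-≤ 2 (r M (F ∪ F')) 2 (begin
    r M (F ∪ F') + 2            ≤⟨ +-monoʳ-≤ (r M (F ∪ F')) 2≤r∩ ⟩
    r M (F ∪ F') + r M (F ∩ F') ≤⟨ r-submod M F F' ⟩
    r M F + r M F'              ≡⟨ cong₂ _+_ rF≡2 rF'≡2 ⟩
    2 + 2                       ∎)
    where open ≤-Reasoning

  face-mono : ∀ {F G} → F ⊆ G → r M G ≤ r M F → ∀ B → Face M (F ∷ []) B → Face M (G ∷ []) B
  face-mono {F} {G} F⊆G rG≤rF B (isB , tightF ∷ []) =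
    isB , ≤-antisym (∣I∩G∣≤r G (proj₁ isB)) (begin
      r M G      ≤⟨ rG≤rF ⟩
      r M F      ≡⟨ tightF ⟨
      ∣ B ∩ F ∣  ≤⟨ p⊆q⇒∣p∣≤∣q∣ (∩-monoʳ B F⊆G) ⟩
      ∣ B ∩ G ∣  ∎) ∷ []
    where open ≤-Reasoning

  facet-absorbs : ∀ {F G} → FacetDefining M F → F ⊆ G → r M G ≤ r M F → ProperFace M (G ∷ [])
                → ∀ B → Face M (G ∷ []) B → Face M (F ∷ []) B
  facet-absorbs {G = G} (_ , maximal) F⊆G rG≤rF properG =
    maximal (G ∷ []) (face-mono F⊆G rG≤rF) properG

  module _ (simple : Simple M) where

    pair-independent : ∀ x y → Independent M (⁅ x ⁆ ∪ ⁅ y ⁆)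
    pair-independent x y = simple _ (∣pair∣≤2 x y)

    base-through : ∀ x y → ∃ λ B → x ∈ B × y ∈ B × IsBase M B
    base-through x y =
      let B , pair⊆B , isB = extend-to-base (pair-independent x y)
      in B , pair⊆B (x∈p∪q⁺ (inj₁ (x∈⁅x⁆ x))) , pair⊆B (x∈p∪q⁺ (inj₂ (x∈⁅x⁆ y))) , isB

    2≤∣∣⇒2≤r : ∀ {X} → 2 ≤ ∣ X ∣ → 2 ≤ r M X
    2≤∣∣⇒2≤r {X} 2≤∣X∣ =
      let x , y , x≢y , x∈X , y∈X = 2≤∣∣⇒two-elements 2≤∣X∣
          pair = ⁅ x ⁆ ∪ ⁅ y ⁆
      in begin
        2            ≤⟨ two-elements⇒2≤∣∣ x≢y (x∈p∪q⁺ (inj₁ (x∈⁅x⁆ x))) (x∈p∪q⁺ (inj₂ (x∈⁅x⁆ y))) ⟩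
        ∣ pair ∣     ≡⟨ pair-independent x y ⟨
        r M pair     ≤⟨ r-mono M pair X (∪-least (⁅⁆⊆ x∈X) (⁅⁆⊆ y∈X)) ⟩
        r M X        ∎
      where open ≤-Reasoning

    line-closed : ∀ {F e} → InF2 M F → e ∉ F → r M (F ∪ ⁅ e ⁆) ≡ 2
                → ¬ ProperFace M (F ∪ ⁅ e ⁆ ∷ [])
    line-closed {F} {e} (rF≡2 , facet) e∉F rG≡2 properG
      with 1≤∣∣⇒nonempty (≤-trans (s≤s z≤n) (≤-trans (≤-reflexive (sym rF≡2)) (r-bound M F)))
    ... | a , a∈F with base-through e a
    ... | B , e∈B , a∈B , isB = <⇒≢ B∩F<B∩G B∩F≡B∩G
      where
      G = F ∪ ⁅ e ⁆
      e∈B∩G : e ∈ B ∩ G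
      e∈B∩G = x∈p∩q⁺ (e∈B , x∈p∪q⁺ (inj₂ (x∈⁅x⁆ e)))
      tightG : ∣ B ∩ G ∣ ≡ r M G
      tightG = ≤-antisym (∣I∩G∣≤r G (proj₁ isB)) (begin
        r M G      ≡⟨ rG≡2 ⟩
        2          ≤⟨ two-elements⇒2≤∣∣ (λ { refl → e∉F a∈F }) e∈B∩G a∈B∩G ⟩
        ∣ B ∩ G ∣  ∎)
        where
        open ≤-Reasoning
        a∈B∩G : a ∈ B ∩ G
        a∈B∩G = x∈p∩q⁺ (a∈B , x∈p∪q⁺ (inj₁ a∈F))
      tightF : ∣ B ∩ F ∣ ≡ r M F
      tightF with facet-absorbs facet (p⊆p∪q ⁅ e ⁆) (≤-reflexive (trans rG≡2 (sym rF≡2))) properG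
                                 B (isB , tightG ∷ [])
      ... | _ , tight ∷ [] = tight
      B∩F<B∩G : ∣ B ∩ F ∣ < ∣ B ∩ G ∣
      B∩F<B∩G = p⊂q⇒∣p∣<∣q∣ (∩-monoʳ B (p⊆p∪q ⁅ e ⁆) , e , e∈B∩G , e∉F ∘ proj₂ ∘ x∈p∩q⁻ B F)
      B∩F≡B∩G : ∣ B ∩ F ∣ ≡ ∣ B ∩ G ∣
      B∩F≡B∩G = trans tightF (trans rF≡2 (trans (sym rG≡2) (sym tightG)))

    module _ (rank2-proper : ∀ G → r M G ≡ 2 → ProperFace M (G ∷ [])) where

      line-maximal : ∀ {F G} → InF2 M F → F ⊆ G → r M G ≤ 2 → G ⊆ F
      line-maximal {F} {G} lineF@(rF≡2 , _) F⊆G rG≤2 {e} e∈G with e ∈? F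
      ... | yes e∈F = e∈F
      ... | no e∉F  = contradiction (rank2-proper _ rF∪e≡2) (line-closed lineF e∉F rF∪e≡2)
        where
        rF∪e≡2 : r M (F ∪ ⁅ e ⁆) ≡ 2
        rF∪e≡2 = ≤-antisym (≤-trans (r-mono M _ G (∪-least F⊆G (⁅⁆⊆ e∈G))) rG≤2)
                           (≤-trans (≤-reflexive (sym rF≡2)) (r-mono M F _ (p⊆p∪q ⁅ e ⁆)))

      -- Distinct lines of 𝓕² share at most one point: otherwise their union
      -- has rank 2, so by maximality it equals each of them.
      lines-meet≤1 : ∀ {F F'} → InF2 M F → InF2 M F' → F ≢ F' → F Meets≤1 F'
      lines-meet≤1 {F} {F'} lineF lineF' F≢F' with ∣ F ∩ F' ∣ ≤? 1
      ... | yes meet≤1 = meet≤1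
      ... | no  meet≰1 = contradiction (⊆-antisym F⊆F' F'⊆F) F≢F'
        where
        r∪≤2 : r M (F ∪ F') ≤ 2
        r∪≤2 = union-rank≤2 (proj₁ lineF) (proj₁ lineF') (2≤∣∣⇒2≤r (≰⇒> meet≰1))
        F⊆F' : F ⊆ F'
        F⊆F' = line-maximal lineF' (q⊆p∪q F F') r∪≤2 ∘ p⊆p∪q F'
        F'⊆F : F' ⊆ F
        F'⊆F = line-maximal lineF (p⊆p∪q F') r∪≤2 ∘ q⊆p∪q F F'

  -- Any set of rank ≤ 2 misses two distinct points: one in A₁ ∪ A₂, and one in
  -- the union of the two parts not containing the first.
  two-outside : ∀ {A₁ A₂ A₃} → ThreePartition M A₁ A₂ A₃
              → ∀ G → r M G ≤ 2 → ∃₂ λ x y → x ≢ y × x ∉ G × y ∉ G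
  two-outside {A₁} {A₂} {A₃} (_ , d₁₂ , d₂₃ , d₃₁ , _ , _ , _ , _ , r₁₂ , r₂₃ , r₃₁) G rG≤2 =
    second-point (escape (rank-gap r₁₂))
    where
    rank-gap : ∀ {A} → r M A ≡ 3 → r M G < r M A
    rank-gap rA≡3 = ≤-trans (s≤s rG≤2) (≤-reflexive (sym rA≡3))
    second-point : (∃ λ x → x ∈ A₁ ∪ A₂ × x ∉ G) → ∃₂ λ x y → x ≢ y × x ∉ G × y ∉ G
    second-point (x , x∈A₁∪A₂ , x∉G) with x∈p∪q⁻ A₁ A₂ x∈A₁∪A₂
    ... | inj₁ x∈A₁ =
      let y , y∈A₂∪A₃ , y∉G = escape (rank-gap r₂₃)
      in x , y , separated d₁₂ (trans (∩-comm A₁ A₃) d₃₁) x∈A₁ y∈A₂∪A₃ , x∉G , y∉G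
    ... | inj₂ x∈A₂ =
      let y , y∈A₃∪A₁ , y∉G = escape (rank-gap r₃₁)
      in x , y , separated d₂₃ (trans (∩-comm A₂ A₁) d₁₂) x∈A₂ y∈A₃∪A₁ , x∉G , y∉G

  -- Every rank-2 set has a proper face: a base through two points outside it
  -- meets it in at most 3 - 2 points.
  rank2-face-proper : Simple M → HasRank M 3 → ∀ {A₁ A₂ A₃} → ThreePartition M A₁ A₂ A₃
                    → ∀ G → r M G ≡ 2 → ProperFace M (G ∷ [])
  rank2-face-proper simple rank3 tp G rG≡2 =
    let x , y , x≢y , x∉G , y∉G = two-outside tp G (≤-reflexive rG≡2)
        B , x∈B , y∈B , isB = base-through simple x y
    in B , isB , λ { (_ , tight ∷ []) → <-irrefl refl (begin
         4              ≡⟨ cong (2 +_) (trans (sym rG≡2) (sym tight)) ⟩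
         2 + ∣ B ∩ G ∣  ≤⟨ trace-misses-two x≢y x∈B y∈B x∉G y∉G ⟩
         ∣ B ∣          ≤⟨ base-size isB ⟩
         r M ⊤          ≡⟨ rank3 ⟩
         3              ∎) }
    where open ≤-Reasoning

in-some-part : ∀ {n} {A₁ A₂ A₃ : Subset n} → A₁ ∪ A₂ ∪ A₃ ≡ ⊤ → ∀ x → x ∈ A₁ ⊎ x ∈ A₂ ⊎ x ∈ A₃
in-some-part {A₁ = A₁} {A₂} {A₃} cover x =
  map₂ (x∈p∪q⁻ A₂ A₃) (x∈p∪q⁻ A₁ (A₂ ∪ A₃) (subst (x ∈_) (sym cover) ∈⊤))

two-traces : ∀ {n} {F X Y Z : Subset n} → (∀ x → x ∈ Z ⊎ x ∈ X ⊎ x ∈ Y) → Empty (F ∩ Z)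
           → f ∣ F ∣ ≤ ∣ F ∩ X ∣ C 2 + ∣ F ∩ Y ∣ C 2
two-traces {F = F} {X} {Y} {Z} parts F∩Z-empty =
  f-bound ∣ F ∩ X ∣ ∣ F ∩ Y ∣ (≤-trans (p⊆q⇒∣p∣≤∣q∣ F⊆traces) (∣p∪q∣≤∣p∣+∣q∣ (F ∩ X) (F ∩ Y)))
  where
  F⊆traces : F ⊆ F ∩ X ∪ F ∩ Y
  F⊆traces {x} x∈F with parts x
  ... | inj₁ x∈Z        = ⊥-elim (F∩Z-empty (x , x∈p∩q⁺ (x∈F , x∈Z)))
  ... | inj₂ (inj₁ x∈X) = x∈p∪q⁺ (inj₁ (x∈p∩q⁺ (x∈F , x∈X)))
  ... | inj₂ (inj₂ x∈Y) = x∈p∪q⁺ (inj₂ (x∈p∩q⁺ (x∈F , x∈Y)))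

line-cost : ∀ {n} {F A₁ A₂ A₃ : Subset n} → (∀ x → x ∈ A₁ ⊎ x ∈ A₂ ⊎ x ∈ A₃)
          → ¬ (Nonempty (F ∩ A₁) × Nonempty (F ∩ A₂) × Nonempty (F ∩ A₃))
          → f ∣ F ∣ ≤ ∣ F ∩ A₁ ∣ C 2 + ∣ F ∩ A₂ ∣ C 2 + ∣ F ∩ A₃ ∣ C 2
line-cost {F = F} {A₁} {A₂} {A₃} parts not-all =
  by-cases (nonempty? (F ∩ A₁)) (nonempty? (F ∩ A₂)) (nonempty? (F ∩ A₃))
  where
  t₁ = ∣ F ∩ A₁ ∣ C 2
  t₂ = ∣ F ∩ A₂ ∣ C 2
  t₃ = ∣ F ∩ A₃ ∣ C 2
  by-cases : Dec (Nonempty (F ∩ A₁)) → Dec (Nonempty (F ∩ A₂)) → Dec (Nonempty (F ∩ A₃))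
           → f ∣ F ∣ ≤ t₁ + t₂ + t₃
  by-cases (no miss₁) _ _ =
    ≤-trans (two-traces parts miss₁)
            (≤-trans (m≤n+m (t₂ + t₃) t₁) (≤-reflexive (sym (+-assoc t₁ t₂ t₃))))
  by-cases (yes _) (no miss₂) _ =
    ≤-trans (two-traces ([ inj₂ ∘ inj₁ , [ inj₁ , inj₂ ∘ inj₂ ]′ ]′ ∘ parts) miss₂)
            (+-monoˡ-≤ t₃ (m≤m+n t₁ t₂))
  by-cases (yes _) (yes _) (no miss₃) =
    ≤-trans (two-traces ([ inj₂ ∘ inj₁ , [ inj₂ ∘ inj₂ , inj₁ ]′ ]′ ∘ parts) miss₃)
            (m≤m+n (t₁ + t₂) t₃)
  by-cases (yes meet₁) (yes meet₂) (yes meet₃) = ⊥-elim (not-all (meet₁ , meet₂ , meet₃))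

lemma4p17 : ∀ {n : ℕ} (M : Matroid n) → Connected M → Simple M → HasRank M 3
    → ∀ (A₁ A₂ A₃ : Subset n) → ThreePartition M A₁ A₂ A₃
    → ∀ (Fs : List (Subset n)) → Unique Fs
    → (∀ F → (F ∈ₗ Fs → InF2 M F) × (InF2 M F → F ∈ₗ Fs))
    → fSum Fs ≤ binomSum A₁ A₂ A₃
-- Each line is paid for by the pairs inside its traces on the parts, and the
-- traces on one part cover at most all pairs of that part.
lemma4p17 M _ simple rank3 A₁ A₂ A₃ tp@(cover , _ , _ , _ , _ , _ , _ , no-transversal , _)
          Fs unique enumerates = begin
  fSum Fs
    ≤⟨ sum-mono (All.map cost lines) ⟩
  sum (map (λ F → trace₁ F + trace₂ F + trace₃ F) Fs)
    ≡⟨ sum-+ (λ F → trace₁ F + trace₂ F) trace₃ Fs ⟩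
  sum (map (λ F → trace₁ F + trace₂ F) Fs) + sum (map trace₃ Fs)
    ≡⟨ cong (_+ sum (map trace₃ Fs)) (sum-+ trace₁ trace₂ Fs) ⟩
  sum (map trace₁ Fs) + sum (map trace₂ Fs) + sum (map trace₃ Fs)
    ≤⟨ +-mono-≤ (+-mono-≤ (packed A₁) (packed A₂)) (packed A₃) ⟩
  binomSum A₁ A₂ A₃
    ∎
  where
  open ≤-Reasoning
  trace₁ trace₂ trace₃ : Subset _ → ℕ
  trace₁ F = ∣ F ∩ A₁ ∣ C 2
  trace₂ F = ∣ F ∩ A₂ ∣ C 2
  trace₃ F = ∣ F ∩ A₃ ∣ C 2
  lines : All (InF2 M) Fs
  lines = All.tabulate (λ {F} → proj₁ (enumerates F))
  cost : ∀ {F} → InF2 M F → f ∣ F ∣ ≤ trace₁ F + trace₂ F + trace₃ F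
  cost lineF = line-cost (in-some-part cover) (no-transversal _ lineF)
  meets≤1 : AllPairs _Meets≤1_ Fs
  meets≤1 = AllPairs-strengthen (lines-meet≤1 M simple (rank2-face-proper M simple rank3 tp))
                                lines unique
  packed : ∀ A → sum (map (λ F → ∣ F ∩ A ∣ C 2) Fs) ≤ ∣ A ∣ C 2
  packed A = traces-packing A meets≤1
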